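{- Let $n \ge 1$, let $\pi$ be a permutation of $\{1, \ldots, n^2\}$, let $\tau$ be a $\pi$-consistent permutation of $\{1, \ldots, n^2\}$ and let $x = (x_1, \ldots, x_{n^2})^T \in \mathbb{Z}^{n^2}$. Then: (i) $1 \le x_i \le n$ for all $i = 1, \ldots, n^2$ if and only if $1 \le x_{\tau^{ -1}(i)} \le n$ for all $i = 1, \ldots, n^2$; (ii) $A_\pi x <> \mathbf{0}$ if and only if $A_\pi \tau(x) <> \mathbf{0}$.
   Context: For $y \in \mathbb{Z}^s$ write $y <> \mathbf{0}$ if every component of $y$ is nonzero. Let $s(n) = \sum_{i=1}^{n-1} i$. The $s(n) \times n$ matrix $A(n)$ is defined inductively: $A(1)$ is the empty matrix, and $A(n) = \begin{pmatrix} \mathbf{1}_{n-1} & -U_{n-1} \\ \mathbf{0}_{s(n-1)} & A(n-1) \end{pmatrix}$, where $\mathbf{1}_{n-1}$ is the all-ones column, $U_{n-1}$ the identity matrix and $\mathbf{0}_{s(n-1)}$ the zero column of length $s(n-1)$. Let $A$ be the $(n \cdot s(n)) \times n^2$ block-diagonal matrix whose $n$ diagonal blocks all equal $A(n)$. For a permutation $\pi$ of $\{1,\ldots,n^2\}$, $A_\pi$ is the matrix whose $j$-th column is the $\pi^{ -1}(j)$-th column of $A$. For a permutation $\tau$ and $x \in \mathbb{Z}^{n^2}$, $\tau(x) = (x_{\tau^{ -1}(1)}, \ldots, x_{\tau^{ -1}(n^2)})^T$. The constraint sets of $\pi$ are $cs_\pi(j) = \{\pi(i) \mid (j-1)n +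 1 \le i \le jn\}$, $j=1,\ldots,n$. A permutation $\tau$ of $\{1,\ldots,n^2\}$ is $\pi$-consistent if $\tau(cs_\pi(j)) = cs_\pi(j)$ for $j = 1, \ldots, n$. -}

module Defs where

open import Data.Nat using (ℕ; zero; suc; _*_) renaming (_+_ to _+ℕ_)
open import Data.Integer using (ℤ; +_; -_; 0ℤ; 1ℤ) renaming (_+_ to _+ℤ_; _*_ to _*ℤ_)
open import Data.Fin using (Fin; zero; suc; splitAt; remQuot; _≟_)
open import Data.Fin.Permutation using (Permutation′; _⟨$⟩ʳ_; _⟨$⟩ˡ_)
open import Data.Sum using (inj₁; inj₂)
open import Data.Product using (Σ; _×_; proj₁; proj₂; ∃; _,_)
open import Relation.Binary.PropositionalEquality using (_≡_; _≢_)
open import Relation.Nullary using (yes; no)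
open import Function.Bundles using (_⇔_)

-- Indices are 0-based: Fin m = {0,…,m-1} stands for {1,…,m}.

-- s(n) = Σ_{i=1}^{n-1} i ; s(0) = 0 (unused), s(1) = 0, s(n+1) = n + s(n)
s : ℕ → ℕ
s zero = 0
s (suc n) = n +ℕ s n

Mat : ℕ → ℕ → Set
Mat r c = Fin r → Fin c → ℤ

δ : ∀ {m} → Fin m → Fin m → ℤ
δ i j with i ≟ j
... | yes _ = 1ℤ
... | no _ = 0ℤ

-- A(n) : s(n) × n matrix.  A(0) and A(1) have no rows.
-- A(n+1) = ( 1_n  -U_n ; 0_{s(n)}  A(n) )
An : (n : ℕ) → Mat (s n) n
An zero ()
An (suc n) r c with splitAt n r
An (suc n) r zero    | inj₁ i = 1ℤ
An (suc n) r (suc j) | inj₁ i = - δ i j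
An (suc n) r zero    | inj₂ k = 0ℤ
An (suc n) r (suc j) | inj₂ k = An n k j

-- block diagonal (n·s(n)) × n² matrix with n diagonal blocks A(n).
blockA : (n : ℕ) → Mat (n * s n) (n * n)
blockA n r c with remQuot {n} (s n) r | remQuot {n} n c
... | (br , lr) | (bc , lc) with br ≟ bc
...   | yes _ = An n lr lc
...   | no _ = 0ℤ

Aπ : (n : ℕ) → Permutation′ (n * n) → Mat (n * s n) (n * n)
Aπ n π r j = blockA n r (π ⟨$⟩ˡ j)

actPerm : ∀ {m} → Permutation′ m → (Fin m → ℤ) → (Fin m → ℤ)
actPerm τ x i = x (τ ⟨$⟩ˡ i)

∑ : ∀ {m} → (Fin m → ℤ) → ℤ
∑ {zero} f = 0ℤ
∑ {suc m} f = f zero +ℤ ∑ (λ i → f (suc i))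

_·_ : ∀ {r c} → Mat r c → (Fin c → ℤ) → (Fin r → ℤ)
(M · x) i = ∑ (λ j → M i j *ℤ x j)

-- y <> 0 : every component nonzero
AllNonzero : ∀ {m} → (Fin m → ℤ) → Set
AllNonzero y = ∀ i → y i ≢ 0ℤ

-- membership in constraint set cs_π(j) = { π(i) | i in the j-th block of n indices }
InCS : (n : ℕ) → Permutation′ (n * n) → Fin n → Fin (n * n) → Set
InCS n π j k = ∃ λ i → (proj₁ (remQuot {n} n i) ≡ j) × (π ⟨$⟩ʳ i ≡ k)

-- τ is π-consistent: τ(cs_π(j)) = cs_π(j) for all j (set equality)
Consistent : (n : ℕ) → Permutation′ (n * n) → Permutation′ (n * n) → Set
Consistent n π τ = ∀ (j : Fin n) (k : Fin (n * n)) →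
  (∃ λ i → InCS n π j i × (τ ⟨$⟩ʳ i ≡ k)) ⇔ InCS n π j k

module Submission where

-- Every row of A(n) is e_a - e_b for some a ≠ b, and every
-- pair a ≠ b occurs (up to sign) as a row; this is proved by induction on n
-- from the block shape (1 | -U ; 0 | A(n-1)).  Hence every row of the
-- block-diagonal matrix A, and of its column permutation A_π, computes a
-- difference x_p - x_q of two distinct entries lying in one constraint set
-- of π, and every such difference is a row.  So
--     A_π x <> 0   iff   x is injective on every constraint set of π.
-- A π-consistent τ maps each constraint set onto itself, so x is injective
-- on the constraint sets iff τ(x) is; this gives (ii).  Part (i) holds for
-- any permutation τ, as it only reindexes a pointwise condition.

open import Defs
open import Data.Nat using (ℕ; _≤_; _*_; zero; suc)
open import Data.Integer using (ℤ; +_; -_; 0ℤ; 1ℤ; _-_)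
  renaming (_≤_ to _≤ℤ_; _+_ to _+ℤ_; _*_ to _*ℤ_)
import Data.Integer.Properties as ℤP
open import Data.Integer.Tactic.RingSolver using (solve-∀)
open import Data.Fin using (Fin; zero; suc; splitAt; remQuot; quotRem; combine; _≟_; _↑ˡ_; _↑ʳ_)
open import Data.Fin.Properties
  using (remQuot-combine; combine-remQuot; combine-surjective; combine-injectiveˡ; combine-injectiveʳ;
         splitAt-↑ˡ; splitAt-↑ʳ; suc-injective)
open import Data.Fin.Permutation using (Permutation′; _⟨$⟩ʳ_; _⟨$⟩ˡ_; inverseˡ; inverseʳ)
open import Data.Product using (∃; ∃₂; _×_; _,_; proj₁)
open import Data.Sum using (_⊎_; inj₁; inj₂)
open import Data.Empty using (⊥-elim)
open import Function.Base using (_∘_)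
open import Relation.Nullary using (yes; no)
open import Relation.Binary.PropositionalEquality
open import Function.Bundles using (_⇔_; mk⇔; Equivalence)
import Function.Properties.Equivalence as ⇔

δ-refl : ∀ {m} (i : Fin m) → δ i i ≡ 1ℤ
δ-refl i with i ≟ i
... | yes _ = refl
... | no i≢i = ⊥-elim (i≢i refl)

δ-≢ : ∀ {m} (i j : Fin m) → i ≢ j → δ i j ≡ 0ℤ
δ-≢ i j i≢j with i ≟ j
... | yes i≡j = ⊥-elim (i≢j i≡j)
... | no _ = refl

δ-cong⇔ : ∀ {m k} (i j : Fin m) (i′ j′ : Fin k) →
  (i ≡ j → i′ ≡ j′) → (i′ ≡ j′ → i ≡ j) → δ i j ≡ δ i′ j′
δ-cong⇔ i j i′ j′ to from with i ≟ j | i′ ≟ j′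
... | yes _ | yes _ = refl
... | no _ | no _ = refl
... | yes i≡j | no i′≢j′ = ⊥-elim (i′≢j′ (to i≡j))
... | no i≢j | yes i′≡j′ = ⊥-elim (i≢j (from i′≡j′))

δ-suc : ∀ {m} (i j : Fin m) → δ (suc i) (suc j) ≡ δ i j
δ-suc i j = δ-cong⇔ (suc i) (suc j) i j suc-injective (cong suc)

∑-cong : ∀ {m} {f g : Fin m → ℤ} → (∀ j → f j ≡ g j) → ∑ f ≡ ∑ g
∑-cong {zero} f≡g = refl
∑-cong {suc m} f≡g = cong₂ _+ℤ_ (f≡g zero) (∑-cong (f≡g ∘ suc))

∑-zero : ∀ {m} {f : Fin m → ℤ} → (∀ j → f j ≡ 0ℤ) → ∑ f ≡ 0ℤ
∑-zero {zero} f≡0 = refl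
∑-zero {suc m} f≡0 = cong₂ _+ℤ_ (f≡0 zero) (∑-zero (f≡0 ∘ suc))

∑-minus : ∀ {m} (f g : Fin m → ℤ) → ∑ (λ j → f j - g j) ≡ ∑ f - ∑ g
∑-minus {zero} f g = refl
∑-minus {suc m} f g =
  trans (cong ((f zero - g zero) +ℤ_) (∑-minus (f ∘ suc) (g ∘ suc)))
        (interchange (f zero) (g zero) (∑ (f ∘ suc)) (∑ (g ∘ suc)))
  where
  interchange : ∀ (a b c d : ℤ) → (a - b) +ℤ (c - d) ≡ (a +ℤ c) - (b +ℤ d)
  interchange = solve-∀

∑-δ : ∀ {m} (p : Fin m) (x : Fin m → ℤ) → ∑ (λ j → δ p j *ℤ x j) ≡ x p
∑-δ {suc m} zero x = begin
  δ {suc m} zero zero *ℤ x zero +ℤ ∑ (λ j → δ zero (suc j) *ℤ x (suc j))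
    ≡⟨ cong₂ _+ℤ_ (cong (_*ℤ x zero) (δ-refl {suc m} zero))
                  (∑-zero (λ j → trans (cong (_*ℤ x (suc j)) (δ-≢ zero (suc j) (λ ()))) (ℤP.*-zeroˡ (x (suc j))))) ⟩
  1ℤ *ℤ x zero +ℤ 0ℤ
    ≡⟨ trans (ℤP.+-identityʳ _) (ℤP.*-identityˡ (x zero)) ⟩
  x zero ∎
  where open ≡-Reasoning
∑-δ (suc p) x = begin
  δ (suc p) zero *ℤ x zero +ℤ ∑ (λ j → δ (suc p) (suc j) *ℤ x (suc j))
    ≡⟨ cong₂ _+ℤ_ (trans (cong (_*ℤ x zero) (δ-≢ (suc p) zero (λ ()))) (ℤP.*-zeroˡ (x zero)))
                  (∑-cong (λ j → cong (_*ℤ x (suc j)) (δ-suc p j))) ⟩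
  0ℤ +ℤ ∑ (λ j → δ p j *ℤ x (suc j))
    ≡⟨ trans (ℤP.+-identityˡ _) (∑-δ p (x ∘ suc)) ⟩
  x (suc p) ∎
  where open ≡-Reasoning

IsDiff : ∀ {m} → (Fin m → ℤ) → Fin m → Fin m → Set
IsDiff v a b = ∀ c → v c ≡ δ a c - δ b c

IsDiff-apply : ∀ {m} {v : Fin m → ℤ} {a b} → IsDiff v a b →
  ∀ x → ∑ (λ c → v c *ℤ x c) ≡ x a - x b
IsDiff-apply {v = v} {a} {b} v≡ x = begin
  ∑ (λ c → v c *ℤ x c)
    ≡⟨ ∑-cong (λ c → trans (cong (_*ℤ x c) (v≡ c)) (distrib (δ a c) (δ b c) (x c))) ⟩
  ∑ (λ c → δ a c *ℤ x c - δ b c *ℤ x c)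
    ≡⟨ ∑-minus (λ c → δ a c *ℤ x c) (λ c → δ b c *ℤ x c) ⟩
  ∑ (λ c → δ a c *ℤ x c) - ∑ (λ c → δ b c *ℤ x c)
    ≡⟨ cong₂ _-_ (∑-δ a x) (∑-δ b x) ⟩
  x a - x b ∎
  where
  open ≡-Reasoning
  distrib : ∀ (a b y : ℤ) → (a - b) *ℤ y ≡ a *ℤ y - b *ℤ y
  distrib = solve-∀

permInjʳ : ∀ {m} (π : Permutation′ m) {u v} → π ⟨$⟩ʳ u ≡ π ⟨$⟩ʳ v → u ≡ v
permInjʳ π e = trans (sym (inverseˡ π)) (trans (cong (π ⟨$⟩ˡ_) e) (inverseˡ π))

permInjˡ : ∀ {m} (π : Permutation′ m) {u v} → π ⟨$⟩ˡ u ≡ π ⟨$⟩ˡ v → u ≡ v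
permInjˡ π e = trans (sym (inverseʳ π)) (trans (cong (π ⟨$⟩ʳ_) e) (inverseʳ π))

IsDiff-permute : ∀ {m} (π : Permutation′ m) {v : Fin m → ℤ} {a b} → IsDiff v a b →
  IsDiff (λ c → v (π ⟨$⟩ˡ c)) (π ⟨$⟩ʳ a) (π ⟨$⟩ʳ b)
IsDiff-permute π {a = a} {b} v≡ c = trans (v≡ (π ⟨$⟩ˡ c)) (cong₂ _-_ (δ-π a) (δ-π b))
  where
  δ-π : ∀ u → δ u (π ⟨$⟩ˡ c) ≡ δ (π ⟨$⟩ʳ u) c
  δ-π u = δ-cong⇔ u (π ⟨$⟩ˡ c) (π ⟨$⟩ʳ u) c
            (λ e → trans (cong (π ⟨$⟩ʳ_) e) (inverseʳ π))
            (λ e → permInjʳ π (trans e (sym (inverseʳ π))))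

An-upper-row : ∀ n (r : Fin (s (suc n))) i → splitAt n r ≡ inj₁ i →
  IsDiff (An (suc n) r) zero (suc i)
An-upper-row n r i eq c with splitAt n r
An-upper-row n r i refl zero | .(inj₁ i) = sym (cong₂ _-_ (δ-refl {suc n} zero) (δ-≢ (suc i) zero (λ ())))
An-upper-row n r i refl (suc j) | .(inj₁ i) =
  sym (trans (cong₂ _-_ (δ-≢ zero (suc j) (λ ())) (δ-suc i j)) (ℤP.+-identityˡ (- δ i j)))

An-lower-row : ∀ n (r : Fin (s (suc n))) k → splitAt n r ≡ inj₂ k → ∀ {a b} →
  IsDiff (An n k) a b → IsDiff (An (suc n) r) (suc a) (suc b)
An-lower-row n r k eq v≡ c with splitAt n r
An-lower-row n r k refl {a} {b} v≡ zero | .(inj₂ k) = sym (cong₂ _-_ (δ-≢ (suc a) zero (λ ())) (δ-≢ (suc b) zero (λ ())))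
An-lower-row n r k refl {a} {b} v≡ (suc j) | .(inj₂ k) =
  trans (v≡ j) (sym (cong₂ _-_ (δ-suc a j) (δ-suc b j)))

An-row-is-diff : ∀ n (r : Fin (s n)) → ∃₂ λ a b → a ≢ b × IsDiff (An n r) a b
An-row-is-diff (suc n) r = by-block (splitAt n r) refl
  where
  by-block : ∀ half → splitAt n r ≡ half → ∃₂ λ a b → a ≢ b × IsDiff (An (suc n) r) a b
  by-block (inj₁ i) eq = zero , suc i , (λ ()) , An-upper-row n r i eq
  by-block (inj₂ k) eq with An-row-is-diff n k
  ... | a , b , a≢b , v≡ = suc a , suc b , a≢b ∘ suc-injective , An-lower-row n r k eq v≡

An-diff-is-row : ∀ n (a b : Fin n) → a ≢ b →
  ∃ λ r → IsDiff (An n r) a b ⊎ IsDiff (An n r) b a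
An-diff-is-row (suc n) zero zero a≢b = ⊥-elim (a≢b refl)
An-diff-is-row (suc n) zero (suc i) _ =
  i ↑ˡ s n , inj₁ (An-upper-row n (i ↑ˡ s n) i (splitAt-↑ˡ n i (s n)))
An-diff-is-row (suc n) (suc i) zero _ =
  i ↑ˡ s n , inj₂ (An-upper-row n (i ↑ˡ s n) i (splitAt-↑ˡ n i (s n)))
An-diff-is-row (suc n) (suc a) (suc b) a≢b with An-diff-is-row n a b (a≢b ∘ cong suc)
... | k , inj₁ v≡ = n ↑ʳ k , inj₁ (An-lower-row n (n ↑ʳ k) k (splitAt-↑ʳ n (s n) k) v≡)
... | k , inj₂ v≡ = n ↑ʳ k , inj₂ (An-lower-row n (n ↑ʳ k) k (splitAt-↑ʳ n (s n) k) v≡)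

blockA-diag : ∀ n (b : Fin n) lr lc → blockA n (combine b lr) (combine b lc) ≡ An n lr lc
blockA-diag n b lr lc
  with quotRem {n} (s n) (combine b lr) | remQuot-combine {n} {s n} b lr
     | quotRem {n} n (combine b lc) | remQuot-combine {n} {n} b lc
... | _ | refl | _ | refl with b ≟ b
...   | yes _ = refl
...   | no b≢b = ⊥-elim (b≢b refl)

blockA-offdiag : ∀ n {br bc : Fin n} → br ≢ bc → ∀ lr lc →
  blockA n (combine br lr) (combine bc lc) ≡ 0ℤ
blockA-offdiag n {br} {bc} br≢bc lr lc
  with quotRem {n} (s n) (combine br lr) | remQuot-combine {n} {s n} br lr
     | quotRem {n} n (combine bc lc) | remQuot-combine {n} {n} bc lc
... | _ | refl | _ | refl with br ≟ bc
...   | yes br≡bc = ⊥-elim (br≢bc br≡bc)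
...   | no _ = refl

blockA-row : ∀ n (br : Fin n) lr {a b} → IsDiff (An n lr) a b →
  IsDiff (blockA n (combine br lr)) (combine br a) (combine br b)
blockA-row n br lr {a} {b} v≡ c with combine-surjective {n} {n} c
... | bc , lc , refl with br ≟ bc
...   | yes refl = trans (blockA-diag n br lr lc) (trans (v≡ lc) (cong₂ _-_ (δ-block a) (δ-block b)))
  where
  δ-block : ∀ u → δ u lc ≡ δ (combine br u) (combine br lc)
  δ-block u = δ-cong⇔ u lc (combine br u) (combine br lc) (cong (combine br)) (combine-injectiveʳ br u br lc)
...   | no br≢bc = trans (blockA-offdiag n br≢bc lr lc) (sym (cong₂ _-_ (δ-other a) (δ-other b)))
  where
  δ-other : ∀ u → δ (combine br u) (combine bc lc) ≡ 0ℤ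
  δ-other u = δ-≢ _ _ (br≢bc ∘ combine-injectiveˡ br u bc lc)

Aπ-row : ∀ n (π : Permutation′ (n * n)) br lr {a b} → IsDiff (An n lr) a b → ∀ x →
  (Aπ n π · x) (combine br lr) ≡ x (π ⟨$⟩ʳ combine br a) - x (π ⟨$⟩ʳ combine br b)
Aπ-row n π br lr v≡ = IsDiff-apply (IsDiff-permute π (blockA-row n br lr v≡))

InCS-combine : ∀ n (π : Permutation′ (n * n)) j a → InCS n π j (π ⟨$⟩ʳ combine j a)
InCS-combine n π j a = combine j a , cong proj₁ (remQuot-combine j a) , refl

InCS-elim : ∀ n (π : Permutation′ (n * n)) j {p} → InCS n π j p → ∃ λ a → π ⟨$⟩ʳ combine j a ≡ p
InCS-elim n π .(proj₁ (remQuot {n} n i)) (i , refl , refl) =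
  _ , cong (π ⟨$⟩ʳ_) (combine-remQuot {n} n i)

DistinctOnCS : ∀ n → Permutation′ (n * n) → (Fin (n * n) → ℤ) → Set
DistinctOnCS n π x = ∀ j {p q} → InCS n π j p → InCS n π j q → p ≢ q → x p ≢ x q

nonzero⇔distinct : ∀ n (π : Permutation′ (n * n)) x → AllNonzero (Aπ n π · x) ⇔ DistinctOnCS n π x
nonzero⇔distinct n π x = mk⇔ nonzero⇒distinct distinct⇒nonzero
  where
  difference-zero : ∀ {u v : ℤ} → u ≡ v → u - v ≡ 0ℤ
  difference-zero {u} refl = ℤP.+-inverseʳ u

  nonzero⇒distinct : AllNonzero (Aπ n π · x) → DistinctOnCS n π x
  nonzero⇒distinct nz j p∈ q∈ p≢q xp≡xq with InCS-elim n π j p∈ | InCS-elim n π j q∈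
  ... | a , refl | b , refl with An-diff-is-row n a b (p≢q ∘ cong (λ t → π ⟨$⟩ʳ combine j t))
  ...   | lr , inj₁ v≡ = nz (combine j lr) (trans (Aπ-row n π j lr v≡ x) (difference-zero xp≡xq))
  ...   | lr , inj₂ v≡ = nz (combine j lr) (trans (Aπ-row n π j lr v≡ x) (difference-zero (sym xp≡xq)))

  distinct⇒nonzero : DistinctOnCS n π x → AllNonzero (Aπ n π · x)
  distinct⇒nonzero dist r row≡0 with combine-surjective {n} {s n} r
  ... | br , lr , refl with An-row-is-diff n lr
  ...   | a , b , a≢b , v≡ =
    dist br (InCS-combine n π br a) (InCS-combine n π br b)
         (a≢b ∘ combine-injectiveʳ br a br b ∘ permInjʳ π)
         (ℤP.i-j≡0⇒i≡j _ _ (trans (sym (Aπ-row n π br lr v≡ x)) row≡0))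

distinct-pullback : ∀ n (π : Permutation′ (n * n)) (g : Fin (n * n) → Fin (n * n)) →
  (∀ {u v} → g u ≡ g v → u ≡ v) → (∀ j {k} → InCS n π j k → InCS n π j (g k)) →
  ∀ {x y} → (∀ k → x k ≡ y (g k)) → DistinctOnCS n π y → DistinctOnCS n π x
distinct-pullback n π g g-inj g-pres x≡y∘g dist j {p} {q} p∈ q∈ p≢q xp≡xq =
  dist j (g-pres j p∈) (g-pres j q∈) (p≢q ∘ g-inj) (trans (sym (x≡y∘g p)) (trans xp≡xq (x≡y∘g q)))

consistent-preservesʳ : ∀ n {π τ} → Consistent n π τ → ∀ j {k} → InCS n π j k → InCS n π j (τ ⟨$⟩ʳ k)
consistent-preservesʳ n cons j {k} k∈ = Equivalence.to (cons j _) (k , k∈ , refl)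

consistent-preservesˡ : ∀ n {π τ} → Consistent n π τ → ∀ j {k} → InCS n π j k → InCS n π j (τ ⟨$⟩ˡ k)
consistent-preservesˡ n {π} {τ} cons j k∈ with Equivalence.from (cons j _) k∈
... | i , i∈ , refl = subst (InCS n π j) (sym (inverseˡ τ)) i∈

consistent-distinct : ∀ n (π τ : Permutation′ (n * n)) → Consistent n π τ → ∀ x →
  DistinctOnCS n π x ⇔ DistinctOnCS n π (actPerm τ x)
consistent-distinct n π τ cons x = mk⇔
  (distinct-pullback n π (τ ⟨$⟩ˡ_) (permInjˡ τ) (consistent-preservesˡ n {π} {τ} cons) (λ _ → refl))
  (distinct-pullback n π (τ ⟨$⟩ʳ_) (permInjʳ τ) (consistent-preservesʳ n {π} {τ} cons) (λ _ → cong x (sym (inverseˡ τ))))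

all-permute : ∀ {m} (τ : Permutation′ m) (P : ℤ → Set) (x : Fin m → ℤ) →
  (∀ i → P (x i)) ⇔ (∀ i → P (x (τ ⟨$⟩ˡ i)))
all-permute τ P x = mk⇔ (λ all i → all (τ ⟨$⟩ˡ i))
                        (λ all i → subst (P ∘ x) (inverseˡ τ) (all (τ ⟨$⟩ʳ i)))

lemma4p2 : (n : ℕ) → 1 ≤ n → (π τ : Permutation′ (n * n)) → Consistent n π τ →
    (x : Fin (n * n) → ℤ) →
    ((∀ i → (+ 1 ≤ℤ x i) × (x i ≤ℤ + n)) ⇔ (∀ i → (+ 1 ≤ℤ x (τ ⟨$⟩ˡ i)) × (x (τ ⟨$⟩ˡ i) ≤ℤ + n)))
    × (AllNonzero (Aπ n π · x) ⇔ AllNonzero (Aπ n π · actPerm τ x))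
lemma4p2 n _ π τ cons x =
  all-permute τ (λ z → (+ 1 ≤ℤ z) × (z ≤ℤ + n)) x ,
  ⇔.trans (nonzero⇔distinct n π x)
    (⇔.trans (consistent-distinct n π τ cons x) (⇔.sym (nonzero⇔distinct n π (actPerm τ x))))
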